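{- Let $d\ge 1$ and let $G$ be a finite $d$-regular graph with at least $2d^3+2d-2d^2$ vertices. Then $b(G)=d+1$.
   Context: A $b$-coloring of a graph $G$ is a proper vertex coloring such that every color class contains a vertex (called dominant) adjacent to at least one vertex of each of the other color classes. The $b$-chromatic number $b(G)$ is the largest integer $k$ such that $G$ admits a $b$-coloring with $k$ colors. -}

module Defs where

open import Data.Nat using (ℕ; _+_; _≤_)
open import Data.Bool using (Bool; true; false; if_then_else_)
open import Data.Fin using (Fin)
open import Data.List using (List; map)
open import Data.Nat.ListAction using (sum)
open import Data.List using () renaming (allFin to allFinL)
open import Data.Product using (Σ; _×_)
open import Relation.Binary.PropositionalEquality using (_≡_; _≢_)

record Graph (n : ℕ) : Set where
  field
    adj     : Fin n → Fin n → Bool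
    sym     : ∀ u v → adj u v ≡ adj v u
    irrefl  : ∀ v → adj v v ≡ false

open Graph public

degree : ∀ {n} → Graph n → Fin n → ℕ
degree {n} G v = sum (map (λ u → if adj G v u then 1 else 0) (allFinL n))

Regular : ∀ {n} → ℕ → Graph n → Set
Regular d G = ∀ v → degree G v ≡ d

Proper : ∀ {n k} → Graph n → (Fin n → Fin k) → Set
Proper G c = ∀ u v → adj G u v ≡ true → c u ≢ c v

Dominant : ∀ {n k} → Graph n → (Fin n → Fin k) → Fin n → Set
Dominant {n} G c v =
  ∀ j → j ≢ c v → Σ (Fin n) (λ u → (adj G v u ≡ true) × (c u ≡ j))

IsBColoring : ∀ {n k} → Graph n → (Fin n → Fin k) → Set
IsBColoring {n} {k} G c =
  Proper G c × (∀ (i : Fin k) → Σ (Fin n) (λ v → (c v ≡ i) × Dominant G c v))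

HasBColoring : ∀ {n} → Graph n → ℕ → Set
HasBColoring {n} G k = Σ (Fin n → Fin k) (λ c → IsBColoring G c)

BChromaticNumber : ∀ {n} → Graph n → ℕ → Set
BChromaticNumber G m = HasBColoring G m × (∀ k → HasBColoring G k → k ≤ m)

-- A vertex that is dominant in a b-colouring with k colours sees k − 1 distinct colours among
-- its d neighbours, so b(G) ≤ d + 1.  Conversely, write d = k + 1 and build a partial colouring
-- in d + 1 stages.  Stage s picks a vertex v whose closed neighbourhood is still uncoloured,
-- gives v the colour s and its d neighbours the other d colours bijectively, each avoiding the
-- colours already next to it.  Such a bijection exists as soon as fewer than d
-- (neighbour, colour) pairs are forbidden, and the forbidden pairs are bounded by the paths
-- v – u – x with x already coloured other than s.  A good v exists by averaging: two potentials
-- of the partial colouring grow by at most d² + 1 and k² per stage, and n ≥ 2d³ − 2d² + 2d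
-- keeps the average cost of a vertex below d.  Finally the remaining vertices are coloured
-- greedily, which d + 1 colours allow and which keeps the chosen vertices dominant.

module Submission where

open import Defs hiding (sym)
open import Data.Nat using (ℕ; zero; suc; _+_; _*_; _∸_; _^_; _≤_; _<_; z≤n; s≤s; _≡ᵇ_)
open import Data.Nat.Properties hiding (_≟_)
open import Data.Fin using (Fin; toℕ; fromℕ<; punchIn)
  renaming (zero to fzero; suc to fsuc)
open import Data.Fin.Properties
  using (_≟_; punchIn-injective; punchInᵢ≢i; any?; ¬∀⟶∃¬; toℕ-injective; toℕ-fromℕ<; toℕ<n)
  renaming (0≢1+n to fzero≢fsuc; suc-injective to fsuc-injective)
open import Data.Bool using (Bool; true; false; if_then_else_; _∧_; not)
import Data.Bool.Properties as Bool
open import Data.Maybe using (Maybe; just; nothing; is-just; is-nothing)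
open import Data.Maybe.Properties as Maybe using (just-injective)
open import Data.List as List using ([]; _∷_)
import Data.List.Properties as List
open import Data.List.Membership.Propositional using (_∈_)
open import Data.List.Membership.Propositional.Properties using (∈-allFin)
open import Data.List.Relation.Unary.Any using (here; there)
import Data.Nat.ListAction as ListAction
open import Data.Product using (∃; _×_; _,_; proj₁; proj₂)
open import Data.Sum using (inj₁; inj₂)
open import Data.Nat.Tactic.RingSolver using (solve-∀)
open import Function using (_∘_)
open import Function.Definitions using (Injective)
open import Relation.Nullary using (Dec; yes; no; does; ¬_; contradiction; _×-dec_)
open import Relation.Nullary.Decidable using (dec-true; dec-false)
open import Relation.Binary.PropositionalEquality
open import Algebra.Properties.Semiring.Sum +-*-semiring
  using (sum; sum-syntax; ∑-distrib-+; ∑-comm; *-distribˡ-sum; *-distribʳ-sum; sum-cong-≗;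
         sum-replicate-zero)
import Algebra.Properties.CommutativeSemigroup +-commutativeSemigroup as +
import Algebra.Properties.CommutativeSemigroup *-commutativeSemigroup as *

𝟙 : Bool → ℕ
𝟙 b = if b then 1 else 0

𝟙≤1 : ∀ b → 𝟙 b ≤ 1
𝟙≤1 true = ≤-refl
𝟙≤1 false = z≤n

0<𝟙⇒ : ∀ b → 0 < 𝟙 b → b ≡ true
0<𝟙⇒ true _ = refl

0<𝟙*⇒ : ∀ b m → 0 < 𝟙 b * m → b ≡ true × 0 < m
0<𝟙*⇒ true m 0<m = refl , subst (0 <_) (+-identityʳ m) 0<m

sum-mono-≤ : ∀ {n} {f g : Fin n → ℕ} → (∀ i → f i ≤ g i) → sum f ≤ sum g
sum-mono-≤ {zero} _ = z≤n
sum-mono-≤ {suc n} f≤g = +-mono-≤ (f≤g fzero) (sum-mono-≤ (f≤g ∘ fsuc))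

≤-sum : ∀ {n} (f : Fin n → ℕ) i → f i ≤ sum f
≤-sum f fzero = m≤m+n _ _
≤-sum f (fsuc i) = ≤-trans (≤-sum (f ∘ fsuc) i) (m≤n+m _ _)

sum<n*c⇒∃<c : ∀ {n} (f : Fin n → ℕ) c → sum f < n * c → ∃ λ i → f i < c
sum<n*c⇒∃<c {suc n} f c sum<n*c with f fzero <? c
... | yes f0<c = fzero , f0<c
... | no f0≮c =
  let i , fi<c = sum<n*c⇒∃<c (f ∘ fsuc) c
                   (+-cancelˡ-< c _ _ (≤-<-trans (+-monoˡ-≤ _ (≮⇒≥ f0≮c)) sum<n*c))
  in fsuc i , fi<c

0<sum⇒∃0< : ∀ {n} (f : Fin n → ℕ) → 0 < sum f → ∃ λ i → 0 < f i
0<sum⇒∃0< {suc n} f 0<sum with f fzero in f0≡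
... | suc _ = fzero , subst (0 <_) (sym f0≡) (s≤s z≤n)
... | zero = let i , 0<fi = 0<sum⇒∃0< (f ∘ fsuc) 0<sum in fsuc i , 0<fi

sum-select : ∀ {n} (f : Fin n → ℕ) i → ∑[ j < n ] (𝟙 (does (i ≟ j)) * f j) ≡ f i
sum-select {suc n} f fzero =
  trans (cong₂ _+_ (+-identityʳ (f fzero)) (sum-replicate-zero n)) (+-identityʳ _)
sum-select {suc n} f (fsuc i) = sum-select (f ∘ fsuc) i

sum-tabulate : ∀ {n} (f : Fin n → ℕ) → ListAction.sum (List.tabulate f) ≡ sum f
sum-tabulate {zero} f = refl
sum-tabulate {suc n} f = cong (f fzero +_) (sum-tabulate (f ∘ fsuc))

count : ∀ {n} → (Fin n → Bool) → ℕ
count {n} P = ∑[ x < n ] 𝟙 (P x)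

infixl 6 _─_
_─_ : ∀ {n} → (Fin n → Bool) → Fin n → Fin n → Bool
(P ─ u) x = if does (x ≟ u) then false else P x

─⊆ : ∀ {n} (P : Fin n → Bool) u x → (P ─ u) x ≡ true → P x ≡ true
─⊆ P u x with x ≟ u
... | yes _ = λ ()
... | no _ = λ Px → Px

─≢ : ∀ {n} (P : Fin n → Bool) u x → (P ─ u) x ≡ true → x ≢ u
─≢ P u x with x ≟ u
... | yes _ = λ ()
... | no x≢u = λ _ → x≢u

─-intro : ∀ {n} (P : Fin n → Bool) u x → x ≢ u → P x ≡ true → (P ─ u) x ≡ true
─-intro P u x x≢u Px with x ≟ u
... | yes x≡u = contradiction x≡u x≢u
... | no _ = Px

count-remove : ∀ {n} (P : Fin n → Bool) u → P u ≡ true → count P ≡ suc (count (P ─ u))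
count-remove P fzero Pu rewrite Pu = refl
count-remove P (fsuc u) Pu =
  trans (cong (𝟙 (P fzero) +_) (count-remove (P ∘ fsuc) u Pu)) (+-suc _ _)

sumOver : ∀ {n} → (Fin n → Bool) → (Fin n → ℕ) → ℕ
sumOver {n} P g = ∑[ x < n ] (𝟙 (P x) * g x)

sumOver-mono : ∀ {n} (P : Fin n → Bool) {g h : Fin n → ℕ} → (∀ x → P x ≡ true → g x ≤ h x) →
  sumOver P g ≤ sumOver P h
sumOver-mono P {g} {h} g≤h = sum-mono-≤ λ x → pointwise x (P x) refl
  where
  pointwise : ∀ x b → P x ≡ b → 𝟙 b * g x ≤ 𝟙 b * h x
  pointwise x false _ = z≤n
  pointwise x true Px = *-monoʳ-≤ 1 (g≤h x Px)

sumOver-const : ∀ {n} (P : Fin n → Bool) m → sumOver P (λ _ → m) ≡ count P * m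
sumOver-const P m = sym (*-distribʳ-sum m (𝟙 ∘ P))

sumOver-*ˡ : ∀ {n} (P : Fin n → Bool) m (g : Fin n → ℕ) →
  sumOver P (λ x → m * g x) ≡ m * sumOver P g
sumOver-*ˡ P m g = trans (sum-cong-≗ λ x → *.x∙yz≈y∙xz (𝟙 (P x)) m (g x))
                         (sym (*-distribˡ-sum m (λ x → 𝟙 (P x) * g x)))

sumOver-remove : ∀ {n} (P : Fin n → Bool) (g : Fin n → ℕ) u → P u ≡ true →
  sumOver P g ≡ g u + sumOver (P ─ u) g
sumOver-remove {suc n} P g fzero Pu rewrite Pu =
  cong (_+ sumOver (P ∘ fsuc) (g ∘ fsuc)) (+-identityʳ (g fzero))
sumOver-remove P g (fsuc u) Pu = begin
  𝟙 (P fzero) * g fzero + sumOver (P ∘ fsuc) (g ∘ fsuc)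
    ≡⟨ cong (𝟙 (P fzero) * g fzero +_) (sumOver-remove (P ∘ fsuc) (g ∘ fsuc) u Pu) ⟩
  𝟙 (P fzero) * g fzero + (g (fsuc u) + _)
    ≡⟨ +.x∙yz≈y∙xz (𝟙 (P fzero) * g fzero) (g (fsuc u)) _ ⟩
  g (fsuc u) + (𝟙 (P fzero) * g fzero + _) ∎
  where open ≡-Reasoning

count-split : ∀ {n} (P Q : Fin n → Bool) →
  count P ≡ count (λ x → P x ∧ Q x) + count (λ x → P x ∧ not (Q x))
count-split P Q = trans (sum-cong-≗ (λ x → split (P x) (Q x)))
                        (∑-distrib-+ (λ x → 𝟙 (P x ∧ Q x)) (λ x → 𝟙 (P x ∧ not (Q x))))
  where
  split : ∀ b c → 𝟙 b ≡ 𝟙 (b ∧ c) + 𝟙 (b ∧ not c)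
  split false c = refl
  split true true = refl
  split true false = refl

count-mono : ∀ {n} {P Q : Fin n → Bool} → (∀ x → P x ≡ true → Q x ≡ true) → count P ≤ count Q
count-mono {P = P} {Q} P⊆Q = sum-mono-≤ λ x → 𝟙-mono (P x) (Q x) (P⊆Q x)
  where
  𝟙-mono : ∀ b c → (b ≡ true → c ≡ true) → 𝟙 b ≤ 𝟙 c
  𝟙-mono false c _ = z≤n
  𝟙-mono true c b⇒c rewrite b⇒c refl = ≤-refl

0<count⇒∃ : ∀ {n} (P : Fin n → Bool) → 0 < count P → ∃ λ x → P x ≡ true
0<count⇒∃ P 0<count =
  let x , 0<Px = 0<sum⇒∃0< (𝟙 ∘ P) 0<count in x , 0<𝟙⇒ (P x) 0<Px

count≡0⇒ : ∀ {n} (P : Fin n → Bool) → count P ≡ 0 → ∀ x → P x ≢ true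
count≡0⇒ P count≡0 x Px =
  <⇒≢ (≤-trans (subst (λ b → 1 ≤ 𝟙 b) (sym Px) ≤-refl) (≤-sum (𝟙 ∘ P) x)) (sym count≡0)

injective⇒≤count : ∀ {m n} (P : Fin n → Bool) (f : Fin m → Fin n) →
  (∀ j → P (f j) ≡ true) → Injective _≡_ _≡_ f → m ≤ count P
injective⇒≤count {zero} P f _ _ = z≤n
injective⇒≤count {suc m} P f into inj = begin
  suc m
    ≤⟨ s≤s (injective⇒≤count (P ─ f fzero) (f ∘ fsuc) into′ (fsuc-injective ∘ inj)) ⟩
  suc (count (P ─ f fzero))
    ≡⟨ count-remove P (f fzero) (into fzero) ⟨
  count P ∎
  where
  open ≤-Reasoning
  into′ : ∀ j → (P ─ f fzero) (f (fsuc j)) ≡ true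
  into′ j = ─-intro P (f fzero) (f (fsuc j)) (fzero≢fsuc ∘ sym ∘ inj) (into (fsuc j))

allBut : ∀ {n} → Fin n → Fin n → Bool
allBut c = (λ _ → true) ─ c

count-allBut : ∀ {n} (c : Fin (suc n)) → count (allBut c) ≡ n
count-allBut {n} c = suc-injective (trans (sym (count-remove (λ _ → true) c refl)) (count-all (suc n)))
  where
  count-all : ∀ m → count {m} (λ _ → true) ≡ m
  count-all zero = refl
  count-all (suc m) = cong suc (count-all m)

count-singleton : ∀ {n} (v : Fin n) → count (λ x → does (v ≟ x)) ≡ 1
count-singleton v =
  trans (sum-cong-≗ λ x → sym (*-identityʳ (𝟙 (does (v ≟ x))))) (sum-select (λ _ → 1) v)

∧-true⇒ : ∀ {b c} → b ∧ c ≡ true → b ≡ true × c ≡ true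
∧-true⇒ {true} c≡true = refl , c≡true

∃-outside : ∀ {n} (P Q : Fin n → Bool) → count (λ x → P x ∧ Q x) < count P →
  ∃ λ x → P x ≡ true × Q x ≡ false
∃-outside P Q fewer =
  let x , P∧¬Q = 0<count⇒∃ (λ x → P x ∧ not (Q x)) outside-nonempty
      Px , ¬Qx = ∧-true⇒ P∧¬Q
  in x , Px , not-true⇒ ¬Qx
  where
  not-true⇒ : ∀ {b} → not b ≡ true → b ≡ false
  not-true⇒ {false} _ = refl
  inside outside : ℕ
  inside = count (λ x → P x ∧ Q x)
  outside = count (λ x → P x ∧ not (Q x))
  outside-nonempty : 0 < outside
  outside-nonempty = subst (0 <_) (m+n∸m≡n inside outside)
    (m<n⇒0<n∸m (subst (inside <_) (count-split P Q) fewer))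

-- Removing a member of positive weight, if there is one, lowers the total weight.
removable-member : ∀ {n} m (I : Fin n → Bool) (g : Fin n → ℕ) → 0 < count I → sumOver I g ≤ m →
  ∃ λ u → I u ≡ true × g u ≤ m × sumOver (I ─ u) g ≤ m ∸ 1
removable-member m I g 0<|I| total≤m with sumOver I g in total≡
... | zero =
  let u , Iu = 0<count⇒∃ I 0<|I|
      gu+rest≡0 = trans (sym (sumOver-remove I g u Iu)) total≡
  in u , Iu , ≤-trans (m≤m+n (g u) _) (subst (_≤ m) (sym gu+rest≡0) z≤n)
           , ≤-trans (m≤n+m _ (g u)) (subst (_≤ m ∸ 1) (sym gu+rest≡0) z≤n)
... | suc _ =
  let u , 0<weight = 0<sum⇒∃0< (λ x → 𝟙 (I x) * g x) (subst (0 <_) (sym total≡) (s≤s z≤n))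
      Iu , 0<gu = 0<𝟙*⇒ (I u) (g u) 0<weight
      gu+rest≤m = subst (_≤ m) (trans (sym total≡) (sumOver-remove I g u Iu)) total≤m
  in u , Iu , m+n≤o⇒m≤o (g u) gu+rest≤m
           , m+n≤o⇒m≤o∸n _ (≤-trans (+-monoʳ-≤ _ 0<gu) (subst (_≤ m) (+-comm (g u) _) gu+rest≤m))

∧-monoˡ : ∀ {b b′} c → (b ≡ true → b′ ≡ true) → b ∧ c ≡ true → b′ ∧ c ≡ true
∧-monoˡ {true} c b⇒b′ c≡true rewrite b⇒b′ refl = c≡true

module _ {n k : ℕ} (forbidden : Fin n → Fin (suc k) → Bool) where

  forbiddenIn : (Fin (suc k) → Bool) → Fin n → ℕ
  forbiddenIn P u = count (λ a → P a ∧ forbidden u a)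

  record Assignment (I : Fin n → Bool) (P : Fin (suc k) → Bool) : Set where
    field
      σ : Fin n → Fin (suc k)
      allowed : ∀ {u} → I u ≡ true → P (σ u) ≡ true × forbidden u (σ u) ≡ false
      injective : ∀ {u u′} → I u ≡ true → I u′ ≡ true → σ u ≡ σ u′ → u ≡ u′
      onto : ∀ {a} → P a ≡ true → ∃ λ u → I u ≡ true × σ u ≡ a

  extend-assignment : ∀ {I P u a} → I u ≡ true → P a ≡ true → forbidden u a ≡ false →
    Assignment (I ─ u) (P ─ a) → Assignment I P
  extend-assignment {I} {P} {u} {a} Iu Pa free-a rest = record
    { σ = σ ; allowed = allowed ; injective = injective ; onto = onto }
    where
    open Assignment rest renaming (σ to σ′; allowed to allowed′; injective to injective′; onto to onto′)

    σ : Fin n → Fin (suc k)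
    σ x = if does (x ≟ u) then a else σ′ x

    σ-u : σ u ≡ a
    σ-u rewrite dec-true (u ≟ u) refl = refl

    σ-other : ∀ {x} → x ≢ u → σ x ≡ σ′ x
    σ-other {x} x≢u rewrite dec-false (x ≟ u) x≢u = refl

    allowed : ∀ {x} → I x ≡ true → P (σ x) ≡ true × forbidden x (σ x) ≡ false
    allowed {x} Ix with x ≟ u
    ... | yes refl = Pa , free-a
    ... | no x≢u =
      let P′σ′x , free = allowed′ (─-intro I u x x≢u Ix) in ─⊆ P a (σ′ x) P′σ′x , free

    σ′≢a : ∀ {x} → I x ≡ true → x ≢ u → σ′ x ≢ a
    σ′≢a {x} Ix x≢u = ─≢ P a (σ′ x) (proj₁ (allowed′ (─-intro I u x x≢u Ix)))

    injective : ∀ {x y} → I x ≡ true → I y ≡ true → σ x ≡ σ y → x ≡ y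
    injective {x} {y} Ix Iy σx≡σy with x ≟ u | y ≟ u
    ... | yes refl | yes refl = refl
    ... | yes refl | no y≢u = contradiction (sym σx≡σy) (σ′≢a Iy y≢u)
    ... | no x≢u | yes refl = contradiction σx≡σy (σ′≢a Ix x≢u)
    ... | no x≢u | no y≢u = injective′ (─-intro I u x x≢u Ix) (─-intro I u y y≢u Iy) σx≡σy

    onto : ∀ {b} → P b ≡ true → ∃ λ x → I x ≡ true × σ x ≡ b
    onto {b} Pb with b ≟ a
    ... | yes refl = u , Iu , σ-u
    ... | no b≢a =
      let x , I′x , σ′x≡b = onto′ (─-intro P a b b≢a Pb)
      in x , ─⊆ I u x I′x , trans (σ-other (─≢ I u x I′x)) σ′x≡b

  few-forbidden⇒assignment : ∀ m (I : Fin n → Bool) (P : Fin (suc k) → Bool) →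
    count I ≡ m → count P ≡ m → sumOver I (forbiddenIn P) ≤ m ∸ 1 → Assignment I P
  few-forbidden⇒assignment zero I P |I|≡0 |P|≡0 _ = record
    { σ = λ _ → fzero
    ; allowed = λ {u} Iu → contradiction Iu (count≡0⇒ I |I|≡0 u)
    ; injective = λ {u} Iu _ _ → contradiction Iu (count≡0⇒ I |I|≡0 u)
    ; onto = λ {a} Pa → contradiction Pa (count≡0⇒ P |P|≡0 a)
    }
  few-forbidden⇒assignment (suc m) I P |I|≡1+m |P|≡1+m few
    with removable-member m I (forbiddenIn P) (subst (0 <_) (sym |I|≡1+m) (s≤s z≤n)) few
  ... | u , Iu , forbidden-u≤m , rest-few
    with ∃-outside P (forbidden u) (subst (forbiddenIn P u <_) (sym |P|≡1+m) (s≤s forbidden-u≤m))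
  ... | a , Pa , free-a =
    extend-assignment Iu Pa free-a (few-forbidden⇒assignment m (I ─ u) (P ─ a)
      (suc-injective (trans (sym (count-remove I u Iu)) |I|≡1+m))
      (suc-injective (trans (sym (count-remove P a Pa)) |P|≡1+m))
      (≤-trans (sumOver-mono (I ─ u) λ x _ → count-mono λ b → ∧-monoˡ (forbidden x b) (─⊆ P a b))
               rest-few))

construction-bound : ∀ k → 2 * ((1 + k) * ((1 + k) * ((1 + k) * 1))) + 2 * (1 + k)
                           ≡ 2 * (1 + k) * (k * k + k + 1) + 2 * ((1 + k) * ((1 + k) * 1))
construction-bound = solve-∀

worst-case : ∀ k → (1 + k) * ((1 + k) * ((1 + k) * (1 + k) + 1)) + k * ((1 + k) * (k * k))
                     + (1 + k) * (k * k)
                   ≡ 2 * (1 + k) * (k * k + k + 1) * (1 + k)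
worst-case = solve-∀

stage-budget<n*d : ∀ k s n → 1 ≤ k → s ≤ suc k → 2 * suc k ^ 3 + 2 * suc k ∸ 2 * suc k ^ 2 ≤ n →
  suc k * (s * (suc k * suc k + 1)) + k * (s * (k * k)) < n * suc k
stage-budget<n*d k s n 1≤k s≤d bound≤n = begin-strict
  d * (s * (d * d + 1)) + k * (s * (k * k))
    ≤⟨ +-mono-≤ (*-monoʳ-≤ d (*-monoˡ-≤ _ s≤d)) (*-monoʳ-≤ k (*-monoˡ-≤ _ s≤d)) ⟩
  d * (d * (d * d + 1)) + k * (d * (k * k))
    <⟨ m<m+n _ (≤-trans (s≤s z≤n) (*-monoʳ-≤ d (*-mono-≤ 1≤k 1≤k))) ⟩
  d * (d * (d * d + 1)) + k * (d * (k * k)) + d * (k * k)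
    ≡⟨ worst-case k ⟩
  2 * d * (k * k + k + 1) * d
    ≡⟨ cong (_* d) (trans (sym (m+n∸n≡m (2 * d * (k * k + k + 1)) (2 * d ^ 2)))
                          (cong (_∸ 2 * d ^ 2) (sym (construction-bound k)))) ⟩
  (2 * d ^ 3 + 2 * d ∸ 2 * d ^ 2) * d
    ≤⟨ *-monoˡ-≤ d bound≤n ⟩
  n * d ∎
  where
  open ≤-Reasoning
  d = suc k

closed-neighbourhood-load : ∀ k → 1 + (1 + k) + (1 + k) * k ≡ (1 + k) * (1 + k) + 1
closed-neighbourhood-load = solve-∀

module _ {n : ℕ} (G : Graph n) where

  degree≡count : ∀ v → degree G v ≡ count (adj G v)
  degree≡count v = trans (cong ListAction.sum (List.map-tabulate (λ u → u) (𝟙 ∘ adj G v)))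
                         (sum-tabulate (𝟙 ∘ adj G v))

  adj-irreflexive : ∀ {x y} → adj G x y ≡ true → x ≢ y
  adj-irreflexive {x} xy refl with trans (sym xy) (irrefl G x)
  ... | ()

  adj-symmetric : ∀ {x y} → adj G x y ≡ true → adj G y x ≡ true
  adj-symmetric {x} {y} xy = trans (Graph.sym G y x) xy

  sumOver-adj-swap : ∀ (f g : Fin n → ℕ) →
    ∑[ x < n ] (f x * sumOver (adj G x) g) ≡ ∑[ y < n ] (g y * sumOver (adj G y) f)
  sumOver-adj-swap f g = begin
    ∑[ x < n ] (f x * sumOver (adj G x) g)
      ≡⟨ sum-cong-≗ (λ x → *-distribˡ-sum (f x) (λ y → 𝟙 (adj G x y) * g y)) ⟩
    ∑[ x < n ] ∑[ y < n ] (f x * (𝟙 (adj G x y) * g y))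
      ≡⟨ ∑-comm (λ x y → f x * (𝟙 (adj G x y) * g y)) ⟩
    ∑[ y < n ] ∑[ x < n ] (f x * (𝟙 (adj G x y) * g y))
      ≡⟨ sum-cong-≗ (λ y → sum-cong-≗ λ x →
           trans (*.x∙yz≈z∙yx (f x) (𝟙 (adj G x y)) (g y))
                 (cong (λ b → g y * (𝟙 b * f x)) (Graph.sym G x y))) ⟩
    ∑[ y < n ] ∑[ x < n ] (g y * (𝟙 (adj G y x) * f x))
      ≡⟨ sum-cong-≗ (λ y → *-distribˡ-sum (g y) (λ x → 𝟙 (adj G y x) * f x)) ⟨
    ∑[ y < n ] (g y * sumOver (adj G y) f) ∎
    where open ≡-Reasoning

  dominant⇒≤degree : ∀ {k} (c : Fin n → Fin (suc k)) w → Dominant G c w → k ≤ count (adj G w)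
  dominant⇒≤degree c w dominant =
    injective⇒≤count (adj G w) neighbour (proj₁ ∘ proj₂ ∘ witness) neighbour-injective
    where
    witness : ∀ j → ∃ λ u → adj G w u ≡ true × c u ≡ punchIn (c w) j
    witness j = dominant (punchIn (c w) j) (punchInᵢ≢i (c w) j)
    neighbour = proj₁ ∘ witness
    neighbour-injective : Injective _≡_ _≡_ neighbour
    neighbour-injective {i} {j} same = punchIn-injective (c w) i j
      (trans (sym (proj₂ (proj₂ (witness i)))) (trans (cong c same) (proj₂ (proj₂ (witness j)))))

  b-colouring⇒≤1+d : ∀ {d} → Regular d G → ∀ k → HasBColoring G k → k ≤ suc d
  b-colouring⇒≤1+d regular zero _ = z≤n
  b-colouring⇒≤1+d {d} regular (suc k) (c , _ , dominants) =
    let w , _ , dominant = dominants fzero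
    in s≤s (subst (k ≤_) (trans (sym (degree≡count w)) (regular w)) (dominant⇒≤degree c w dominant))

module PartialColourings {n d : ℕ} (G : Graph n) where

  PartialColouring : Set
  PartialColouring = Fin n → Maybe (Fin (suc d))

  ProperPartial : PartialColouring → Set
  ProperPartial p = ∀ {x y a b} → adj G x y ≡ true → p x ≡ just a → p y ≡ just b → a ≢ b

  infix 4 _⊑_
  _⊑_ : PartialColouring → PartialColouring → Set
  p ⊑ q = ∀ {x a} → p x ≡ just a → q x ≡ just a

  DominantFor : PartialColouring → Fin (suc d) → Fin n → Set
  DominantFor p a w = p w ≡ just a × (∀ j → j ≢ a → ∃ λ u → adj G w u ≡ true × p u ≡ just j)

  DominantFor-⊑ : ∀ {p q a w} → p ⊑ q → DominantFor p a w → DominantFor q a w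
  DominantFor-⊑ p⊑q (pw , sees) = p⊑q pw , λ j j≢a →
    let u , wu , pu = sees j j≢a in u , wu , p⊑q pu

  UsedNear : PartialColouring → Fin n → Fin (suc d) → Set
  UsedNear p x a = ∃ λ u → adj G x u ≡ true × p u ≡ just a

  used? : ∀ p x a → Dec (UsedNear p x a)
  used? p x a = any? λ u → (adj G x u Bool.≟ true) ×-dec (Maybe.≡-dec _≟_ (p u) (just a))

  _[_≔_] : PartialColouring → Fin n → Fin (suc d) → PartialColouring
  (p [ x ≔ a ]) y = if does (y ≟ x) then just a else p y

  [≔]-at : ∀ p x a → (p [ x ≔ a ]) x ≡ just a
  [≔]-at p x a rewrite dec-true (x ≟ x) refl = refl

  ⊑-[≔] : ∀ {p x a} → p x ≡ nothing → p ⊑ p [ x ≔ a ]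
  ⊑-[≔] {x = x} px {y} py with y ≟ x
  ... | yes refl = contradiction (trans (sym px) py) λ ()
  ... | no _ = py

  [≔]-proper : ∀ {p x a} → ProperPartial p → (∀ {u} → adj G x u ≡ true → p u ≢ just a) →
    ProperPartial (p [ x ≔ a ])
  [≔]-proper {p} {x} proper unused {y} {z} yz qy qz with y ≟ x | z ≟ x
  ... | yes refl | yes refl = contradiction refl (adj-irreflexive G yz)
  ... | yes refl | no _ = λ a≡b →
    unused yz (subst (λ b → p z ≡ just b) (sym (trans (just-injective qy) a≡b)) qz)
  ... | no _ | yes refl = λ a≡b →
    unused (adj-symmetric G yz) (subst (λ b → p y ≡ just b) (trans a≡b (sym (just-injective qz))) qy)
  ... | no _ | no _ = proper yz qy qz

  module _ (degree≤d : ∀ v → count (adj G v) ≤ d) where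

    free-colour : ∀ (p : PartialColouring) x →
      ∃ λ a → ∀ {u} → adj G x u ≡ true → p u ≢ just a
    free-colour p x =
      let a , unused = ¬∀⟶∃¬ (suc d) (UsedNear p x) (used? p x) not-all-used
      in a , λ xu pu → unused (_ , xu , pu)
      where
      not-all-used : ¬ (∀ a → UsedNear p x a)
      not-all-used all-used = 1+n≰n (≤-trans
          (injective⇒≤count (adj G x) (proj₁ ∘ all-used) (proj₁ ∘ proj₂ ∘ all-used) injective)
          (degree≤d x))
        where
        injective : Injective _≡_ _≡_ (proj₁ ∘ all-used)
        injective {a} {b} same = just-injective (trans (sym (proj₂ (proj₂ (all-used a))))
                                   (trans (cong p same) (proj₂ (proj₂ (all-used b)))))

    colour-vertex : ∀ p → ProperPartial p → ∀ x →
      ∃ λ q → ProperPartial q × p ⊑ q × ∃ λ a → q x ≡ just a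
    colour-vertex p proper x with p x in px
    ... | just a = p , proper , (λ pu → pu) , a , px
    ... | nothing =
      let a , unused = free-colour p x
      in p [ x ≔ a ] , [≔]-proper proper unused , ⊑-[≔] {p} {x} {a} px , a , [≔]-at p x a

    colour-all : ∀ (xs : List.List (Fin n)) p → ProperPartial p →
      ∃ λ q → ProperPartial q × p ⊑ q × (∀ {x} → x ∈ xs → ∃ λ a → q x ≡ just a)
    colour-all [] p proper = p , proper , (λ px → px) , λ ()
    colour-all (x ∷ xs) p proper =
      let q₁ , proper₁ , p⊑q₁ , a , q₁x = colour-vertex p proper x
          q , proper-q , q₁⊑q , coloured = colour-all xs q₁ proper₁
          coloured′ : ∀ {y} → y ∈ x ∷ xs → ∃ λ b → q y ≡ just b
          coloured′ = λ { (here refl) → a , q₁⊑q q₁x ; (there y∈xs) → coloured y∈xs }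
      in q , proper-q , q₁⊑q ∘ p⊑q₁ , coloured′

    dominant-partial⇒b-colouring : ∀ p → ProperPartial p → (∀ a → ∃ (DominantFor p a)) →
      HasBColoring G (suc d)
    dominant-partial⇒b-colouring p proper dominants = c , proper-c , dominant-c
      where
      completion = colour-all (List.allFin n) p proper
      q = proj₁ completion
      coloured : ∀ y → ∃ λ a → q y ≡ just a
      coloured y = proj₂ (proj₂ (proj₂ completion)) (∈-allFin y)
      c : Fin n → Fin (suc d)
      c y = proj₁ (coloured y)
      c≡ : ∀ {y a} → q y ≡ just a → c y ≡ a
      c≡ {y} qy = just-injective (trans (sym (proj₂ (coloured y))) qy)
      proper-c : Proper G c
      proper-c u v uv = proj₁ (proj₂ completion) uv (proj₂ (coloured u)) (proj₂ (coloured v))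
      dominant-c : ∀ a → ∃ λ w → c w ≡ a × Dominant G c w
      dominant-c a =
        let w , dominant = dominants a
            qw , sees = DominantFor-⊑ (proj₁ (proj₂ (proj₂ completion))) dominant
        in w , c≡ qw , λ j j≢cw →
             let u , wu , qu = sees j (λ j≡a → j≢cw (trans j≡a (sym (c≡ qw)))) in u , wu , c≡ qu

module Construction {n k : ℕ} (G : Graph n) (regular : ∀ v → count (adj G v) ≡ suc k) where

  open PartialColourings {n} {suc k} G

  d : ℕ
  d = suc k

  coloured uncoloured : PartialColouring → Fin n → ℕ
  coloured p x = 𝟙 (is-just (p x))
  uncoloured p x = 𝟙 (is-nothing (p x))

  colouredDegree uncolouredDegree : PartialColouring → Fin n → ℕ
  colouredDegree p y = sumOver (adj G y) (coloured p)
  uncolouredDegree p y = sumOver (adj G y) (uncoloured p)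

  otherThan : Fin (suc d) → Maybe (Fin (suc d)) → Bool
  otherThan c nothing = false
  otherThan c (just a) = allBut c a

  colouredOtherThan : Fin (suc d) → PartialColouring → Fin n → ℕ
  colouredOtherThan c p x = 𝟙 (otherThan c (p x))

  pathsToOther : Fin (suc d) → PartialColouring → Fin n → ℕ
  pathsToOther c p v = sumOver (adj G v) λ u → sumOver (adj G u) (colouredOtherThan c p)

  untouched : PartialColouring → Fin n → Bool
  untouched p v = is-nothing (p v) ∧ (colouredDegree p v ≡ᵇ 0)

  untouchedDegree : PartialColouring → Fin n → ℕ
  untouchedDegree p u = sumOver (adj G u) (𝟙 ∘ untouched p)

  load : PartialColouring → ℕ
  load p = sum (coloured p) + ∑[ y < n ] (coloured p y * uncolouredDegree p y)

  otherLoad : Fin (suc d) → PartialColouring → ℕ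
  otherLoad c p = ∑[ x < n ] (colouredOtherThan c p x * uncolouredDegree p x)

  uncolouredDegree+colouredDegree : ∀ p y → uncolouredDegree p y + colouredDegree p y ≡ d
  uncolouredDegree+colouredDegree p y =
    trans (sym (∑-distrib-+ (λ v → 𝟙 (adj G y v) * uncoloured p v)
                            (λ v → 𝟙 (adj G y v) * coloured p v)))
          (trans (sum-cong-≗ λ v → trans (sym (*-distribˡ-+ (𝟙 (adj G y v)) _ _))
                                        (trans (cong (𝟙 (adj G y v) *_) (split (p v))) (*-identityʳ _)))
                 (regular y))
    where
    split : ∀ (m : Maybe (Fin (suc d))) → 𝟙 (is-nothing m) + 𝟙 (is-just m) ≡ 1
    split nothing = refl
    split (just _) = refl

  coloured-nbr⇒1≤colouredDegree : ∀ {p y x a} → adj G y x ≡ true → p x ≡ just a →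
    1 ≤ colouredDegree p y
  coloured-nbr⇒1≤colouredDegree {p} {y} {x} yx px =
    ≤-trans (≤-reflexive (sym (cong₂ (λ b m → 𝟙 b * 𝟙 (is-just m)) yx px)))
            (≤-sum (λ v → 𝟙 (adj G y v) * coloured p v) x)

  uncolouredDegree≤k : ∀ {p y x a} → adj G y x ≡ true → p x ≡ just a → uncolouredDegree p y ≤ k
  uncolouredDegree≤k {p} {y} yx px = ≤-pred (begin
    suc (uncolouredDegree p y)                  ≡⟨ +-comm 1 _ ⟩
    uncolouredDegree p y + 1                    ≤⟨ +-monoʳ-≤ _ (coloured-nbr⇒1≤colouredDegree yx px) ⟩
    uncolouredDegree p y + colouredDegree p y   ≡⟨ uncolouredDegree+colouredDegree p y ⟩
    d                                           ∎)
    where open ≤-Reasoning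

  uncolouredDegree-⊑ : ∀ {p q} → p ⊑ q → ∀ x → uncolouredDegree q x ≤ uncolouredDegree p x
  uncolouredDegree-⊑ {p} {q} p⊑q x = sumOver-mono (adj G x) λ u _ → uncoloured-⊑ u
    where
    uncoloured-⊑ : ∀ u → uncoloured q u ≤ uncoloured p u
    uncoloured-⊑ u with p u in pu
    ... | nothing = 𝟙≤1 _
    ... | just a = subst (λ m → 𝟙 (is-nothing m) ≤ 0) (sym (p⊑q pu)) z≤n

  untouched⇒uncoloured : ∀ {p v} → untouched p v ≡ true → p v ≡ nothing
  untouched⇒uncoloured {p} {v} with p v
  ... | nothing = λ _ → refl
  ... | just _ = λ ()

  untouched⇒colouredDegree≡0 : ∀ {p v} → untouched p v ≡ true → colouredDegree p v ≡ 0
  untouched⇒colouredDegree≡0 {p} {v} with is-nothing (p v) | colouredDegree p v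
  ... | true | zero = λ _ → refl
  ... | true | suc _ = λ ()
  ... | false | _ = λ ()

  untouched⇒nbr-uncoloured : ∀ {p v u} → untouched p v ≡ true → adj G v u ≡ true → p u ≡ nothing
  untouched⇒nbr-uncoloured {p} {v} {u} untouched-v vu with p u in pu
  ... | nothing = refl
  ... | just a = contradiction (untouched⇒colouredDegree≡0 untouched-v)
                               (>⇒≢ (coloured-nbr⇒1≤colouredDegree vu pu))

  -- A coloured neighbour leaves u at most k uncoloured neighbours, and a coloured u has no
  -- untouched neighbour at all.
  untouchedDegree≤ : ∀ {p x a u} → p x ≡ just a → adj G x u ≡ true →
    untouchedDegree p u ≤ k * uncoloured p u
  untouchedDegree≤ {p} {x} {a} {u} px xu with p u in pu
  ... | just b = begin
    untouchedDegree p u            ≤⟨ sumOver-mono (adj G u) no-untouched-nbr ⟩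
    sumOver (adj G u) (λ _ → 0)    ≡⟨ trans (sumOver-const (adj G u) 0) (*-zeroʳ (count (adj G u))) ⟩
    0                              ≡⟨ *-zeroʳ k ⟨
    k * 0                          ∎
    where
    open ≤-Reasoning
    no-untouched-nbr : ∀ v → adj G u v ≡ true → 𝟙 (untouched p v) ≤ 0
    no-untouched-nbr v uv with untouched p v in untouched-v
    ... | false = z≤n
    ... | true =
      contradiction (trans (sym pu) (untouched⇒nbr-uncoloured untouched-v (adj-symmetric G uv))) λ ()
  ... | nothing = begin
    untouchedDegree p u     ≤⟨ sumOver-mono (adj G u) (λ v _ → untouched≤uncoloured v) ⟩
    uncolouredDegree p u    ≤⟨ uncolouredDegree≤k (adj-symmetric G xu) px ⟩
    k                       ≡⟨ *-identityʳ k ⟨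
    k * 1                   ∎
    where
    open ≤-Reasoning
    untouched≤uncoloured : ∀ v → 𝟙 (untouched p v) ≤ uncoloured p v
    untouched≤uncoloured v with untouched p v in untouched-v
    ... | false = z≤n
    ... | true rewrite untouched⇒uncoloured untouched-v = ≤-refl

  untouched-paths≤ : ∀ c p → ∑[ v < n ] (𝟙 (untouched p v) * pathsToOther c p v) ≤ k * otherLoad c p
  untouched-paths≤ c p = begin
    ∑[ v < n ] (𝟙 (untouched p v) * sumOver (adj G v) S)
      ≡⟨ sumOver-adj-swap G (𝟙 ∘ untouched p) S ⟩
    ∑[ u < n ] (S u * untouchedDegree p u)
      ≡⟨ sum-cong-≗ (λ u → *-comm (S u) _) ⟩
    ∑[ u < n ] (untouchedDegree p u * sumOver (adj G u) X)
      ≡⟨ sumOver-adj-swap G (untouchedDegree p) X ⟩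
    ∑[ x < n ] (X x * sumOver (adj G x) (untouchedDegree p))
      ≤⟨ sum-mono-≤ bound ⟩
    ∑[ x < n ] (X x * (k * uncolouredDegree p x))
      ≡⟨ sum-cong-≗ (λ x → *.x∙yz≈y∙xz (X x) k _) ⟩
    ∑[ x < n ] (k * (X x * uncolouredDegree p x))
      ≡⟨ *-distribˡ-sum k (λ x → X x * uncolouredDegree p x) ⟨
    k * otherLoad c p ∎
    where
    open ≤-Reasoning
    X = colouredOtherThan c p
    S : Fin n → ℕ
    S u = sumOver (adj G u) X
    bound : ∀ x → X x * sumOver (adj G x) (untouchedDegree p) ≤ X x * (k * uncolouredDegree p x)
    bound x with p x in px
    ... | nothing = z≤n
    ... | just a = *-monoʳ-≤ (𝟙 (allBut c a)) (begin
      sumOver (adj G x) (untouchedDegree p)        ≤⟨ sumOver-mono (adj G x) (λ u → untouchedDegree≤ px) ⟩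
      sumOver (adj G x) (λ u → k * uncoloured p u) ≡⟨ sumOver-*ˡ (adj G x) k (uncoloured p) ⟩
      k * uncolouredDegree p x                     ∎)

  cost : Fin (suc d) → PartialColouring → Fin n → ℕ
  cost c p v = if untouched p v then pathsToOther c p v else d

  cost≤ : ∀ c p v → cost c p v ≤
    d * (coloured p v + uncoloured p v * colouredDegree p v) + 𝟙 (untouched p v) * pathsToOther c p v
  cost≤ c p v with untouched p v in untouched-v
  ... | true = ≤-trans (≤-reflexive (sym (+-identityʳ _)))
                       (m≤n+m _ (d * (coloured p v + uncoloured p v * colouredDegree p v)))
  ... | false = ≤-trans (≤-reflexive (sym (*-identityʳ d)))
                  (≤-trans (*-monoʳ-≤ d (¬untouched⇒1≤ untouched-v)) (m≤m+n _ _))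
    where
    ¬untouched⇒1≤ : ∀ {p v} → untouched p v ≡ false →
      1 ≤ coloured p v + uncoloured p v * colouredDegree p v
    ¬untouched⇒1≤ {p} {v} with p v | colouredDegree p v
    ... | just _ | _ = λ _ → s≤s z≤n
    ... | nothing | zero = λ ()
    ... | nothing | suc _ = λ _ → s≤s z≤n

  total-cost≤ : ∀ c p → sum (cost c p) ≤ d * load p + k * otherLoad c p
  total-cost≤ c p = begin
    sum (cost c p)
      ≤⟨ sum-mono-≤ (cost≤ c p) ⟩
    ∑[ v < n ] (d * touched v + K v * pathsToOther c p v)
      ≡⟨ ∑-distrib-+ (λ v → d * touched v) (λ v → K v * pathsToOther c p v) ⟩
    ∑[ v < n ] (d * touched v) + ∑[ v < n ] (K v * pathsToOther c p v)
      ≤⟨ +-mono-≤ (≤-reflexive touched-part) (untouched-paths≤ c p) ⟩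
    d * load p + k * otherLoad c p ∎
    where
    open ≤-Reasoning
    K = 𝟙 ∘ untouched p
    touched : Fin n → ℕ
    touched v = coloured p v + uncoloured p v * colouredDegree p v
    touched-part : ∑[ v < n ] (d * touched v) ≡ d * load p
    touched-part = begin-equality
      ∑[ v < n ] (d * touched v)
        ≡⟨ *-distribˡ-sum d touched ⟨
      d * ∑[ v < n ] touched v
        ≡⟨ cong (d *_) (∑-distrib-+ (coloured p) (λ v → uncoloured p v * colouredDegree p v)) ⟩
      d * (sum (coloured p) + ∑[ v < n ] (uncoloured p v * colouredDegree p v))
        ≡⟨ cong (λ t → d * (sum (coloured p) + t)) (sumOver-adj-swap G (uncoloured p) (coloured p)) ⟩
      d * load p ∎

  find-untouched : ∀ c p s → 1 ≤ k → s ≤ d → 2 * d ^ 3 + 2 * d ∸ 2 * d ^ 2 ≤ n →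
    load p ≤ s * (d * d + 1) → otherLoad c p ≤ s * (k * k) →
    ∃ λ v → untouched p v ≡ true × pathsToOther c p v ≤ k
  find-untouched c p s 1≤k s≤d bound≤n load≤ otherLoad≤ =
    let v , cost<d = sum<n*c⇒∃<c (cost c p) d (begin-strict
          sum (cost c p)                        ≤⟨ total-cost≤ c p ⟩
          d * load p + k * otherLoad c p        ≤⟨ +-mono-≤ (*-monoʳ-≤ d load≤) (*-monoʳ-≤ k otherLoad≤) ⟩
          d * (s * (d * d + 1)) + k * (s * (k * k)) <⟨ stage-budget<n*d k s n 1≤k s≤d bound≤n ⟩
          n * d                                 ∎)
    in v , cheap⇒untouched v cost<d
    where
    open ≤-Reasoning
    cheap⇒untouched : ∀ v → cost c p v < d → untouched p v ≡ true × pathsToOther c p v ≤ k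
    cheap⇒untouched v with untouched p v
    ... | true = λ E<d → refl , ≤-pred E<d
    ... | false = λ d<d → contradiction d<d (<-irrefl refl)

  usedNear : PartialColouring → Fin n → Fin (suc d) → Bool
  usedNear p x a = does (used? p x a)

  hasColour : Maybe (Fin (suc d)) → Fin (suc d) → ℕ
  hasColour nothing _ = 0
  hasColour (just b) a = 𝟙 (does (b ≟ a))

  forbidden≤ : ∀ c p u → forbiddenIn (usedNear p) (allBut c) u ≤ sumOver (adj G u) (colouredOtherThan c p)
  forbidden≤ c p u = begin
    count (λ a → allBut c a ∧ usedNear p u a)
      ≤⟨ sum-mono-≤ witness ⟩
    ∑[ a < suc d ] ∑[ x < n ] term a x
      ≡⟨ ∑-comm term ⟩
    ∑[ x < n ] ∑[ a < suc d ] term a x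
      ≡⟨ sum-cong-≗ (λ x → trans (sym (*-distribˡ-sum (𝟙 (adj G u x)) (weight x)))
                                 (cong (𝟙 (adj G u x) *_) (colour-sum x))) ⟩
    sumOver (adj G u) (colouredOtherThan c p) ∎
    where
    open ≤-Reasoning
    weight : Fin n → Fin (suc d) → ℕ
    weight x a = hasColour (p x) a * 𝟙 (allBut c a)
    term : Fin (suc d) → Fin n → ℕ
    term a x = 𝟙 (adj G u x) * weight x a
    colour-sum : ∀ x → ∑[ a < suc d ] weight x a ≡ colouredOtherThan c p x
    colour-sum x with p x
    ... | nothing = sum-replicate-zero (suc d)
    ... | just b = sum-select (𝟙 ∘ allBut c) b
    witness : ∀ a → 𝟙 (allBut c a ∧ usedNear p u a) ≤ ∑[ x < n ] term a x
    witness a with used? p u a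
    ... | no _ rewrite Bool.∧-zeroʳ (allBut c a) = z≤n
    ... | yes (x , ux , px) rewrite Bool.∧-identityʳ (allBut c a) =
      ≤-trans (≤-reflexive (sym term≡)) (≤-sum (term a) x)
      where
      term≡ : term a x ≡ 𝟙 (allBut c a)
      term≡ rewrite ux | px | dec-true (a ≟ a) refl = trans (*-identityˡ _) (*-identityˡ _)

  record Stage (s : ℕ) : Set where
    field
      colouring : PartialColouring
      proper : ProperPartial colouring
      dominant : ∀ a → toℕ a < s → ∃ (DominantFor colouring a)
      load≤ : load colouring ≤ s * (d * d + 1)
      -- only the colours still to be placed need their paths controlled
      otherLoad≤ : ∀ c → s ≤ toℕ c → otherLoad c colouring ≤ s * (k * k)

  initial : Stage 0
  initial = record
    { colouring = λ _ → nothing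
    ; proper = λ _ ()
    ; dominant = λ _ ()
    ; load≤ = ≤-reflexive (cong₂ _+_ (sum-replicate-zero n) (sum-replicate-zero n))
    ; otherLoad≤ = λ _ _ → ≤-reflexive (sum-replicate-zero n)
    }

  module Extension {s} (stage : Stage s) (c : Fin (suc d)) (toℕ-c : toℕ c ≡ s)
    (v : Fin n) (untouched-v : untouched (Stage.colouring stage) v ≡ true)
    (assignment : Assignment (usedNear (Stage.colouring stage)) (adj G v) (allBut c)) where

    open Stage stage renaming (colouring to p)
    open Assignment assignment

    q : PartialColouring
    q x = if does (x ≟ v) then just c else if adj G v x then just (σ x) else p x

    q-v : q v ≡ just c
    q-v rewrite dec-true (v ≟ v) refl = refl

    q-nbr : ∀ {x} → adj G v x ≡ true → q x ≡ just (σ x)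
    q-nbr {x} vx rewrite dec-false (x ≟ v) (≢-sym (adj-irreflexive G vx)) | vx = refl

    q-far : ∀ {x} → x ≢ v → adj G v x ≡ false → q x ≡ p x
    q-far {x} x≢v vx rewrite dec-false (x ≟ v) x≢v | vx = refl

    data Position : Fin n → Set where
      centre : Position v
      nbr : ∀ {x} → adj G v x ≡ true → Position x
      far : ∀ {x} → x ≢ v → adj G v x ≡ false → Position x

    position : ∀ x → Position x
    position x with x ≟ v
    ... | yes refl = centre
    ... | no x≢v with adj G v x in vx
    ...   | true = nbr vx
    ...   | false = far x≢v vx

    p⊑q : p ⊑ q
    p⊑q {x} px with position x
    ... | centre = contradiction (trans (sym px) (untouched⇒uncoloured untouched-v)) λ ()
    ... | nbr vx = contradiction (trans (sym px) (untouched⇒nbr-uncoloured untouched-v vx)) λ ()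
    ... | far x≢v vx = trans (q-far x≢v vx) px

    σ≢c : ∀ {x} → adj G v x ≡ true → σ x ≢ c
    σ≢c vx = ─≢ (λ _ → true) c _ (proj₁ (allowed vx))

    σ-unused : ∀ {x y b} → adj G v x ≡ true → adj G x y ≡ true → p y ≡ just b → σ x ≢ b
    σ-unused {x} {y} vx xy py refl =
      contradiction (trans (sym (dec-true (used? p x (σ x)) (y , xy , py))) (proj₂ (allowed vx))) λ ()

    proper-q : ProperPartial q
    proper-q {x} {y} xy qx qy with position x | position y
    ... | centre | centre = contradiction refl (adj-irreflexive G xy)
    ... | centre | nbr vy with trans (sym q-v) qx | trans (sym (q-nbr vy)) qy
    ...   | refl | refl = ≢-sym (σ≢c vy)
    proper-q xy qx qy | centre | far _ vy = contradiction (trans (sym xy) vy) λ ()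
    proper-q xy qx qy | nbr vx | centre with trans (sym (q-nbr vx)) qx | trans (sym q-v) qy
    ...   | refl | refl = σ≢c vx
    proper-q xy qx qy | far _ vx | centre = contradiction (trans (sym (adj-symmetric G xy)) vx) λ ()
    proper-q xy qx qy | nbr vx | nbr vy with trans (sym (q-nbr vx)) qx | trans (sym (q-nbr vy)) qy
    ...   | refl | refl = adj-irreflexive G xy ∘ injective vx vy
    proper-q xy qx qy | nbr vx | far y≢v vy with trans (sym (q-nbr vx)) qx
    ...   | refl = σ-unused vx xy (trans (sym (q-far y≢v vy)) qy)
    proper-q xy qx qy | far x≢v vx | nbr vy with trans (sym (q-nbr vy)) qy
    ...   | refl = ≢-sym (σ-unused vy (adj-symmetric G xy) (trans (sym (q-far x≢v vx)) qx))
    proper-q xy qx qy | far x≢v vx | far y≢v vy =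
      proper xy (trans (sym (q-far x≢v vx)) qx) (trans (sym (q-far y≢v vy)) qy)

    dominant-c : DominantFor q c v
    dominant-c = q-v , λ j j≢c →
      let u , vu , σu≡j = onto (─-intro (λ _ → true) c j j≢c refl)
      in u , vu , trans (q-nbr vu) (cong just σu≡j)

    dominant-q : ∀ a → toℕ a < suc s → ∃ (DominantFor q a)
    dominant-q a a<1+s with m<1+n⇒m<n∨m≡n a<1+s
    ... | inj₁ a<s = let w , dominant-w = dominant a a<s in w , DominantFor-⊑ p⊑q dominant-w
    ... | inj₂ a≡s with toℕ-injective (trans a≡s (sym toℕ-c))
    ...   | refl = v , dominant-c

    uncolouredDegree-q-v : uncolouredDegree q v ≤ 0
    uncolouredDegree-q-v = ≤-trans
      (sumOver-mono (adj G v) λ u vu → subst (λ m → 𝟙 (is-nothing m) ≤ 0) (sym (q-nbr vu)) z≤n)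
      (≤-reflexive (trans (sumOver-const (adj G v) 0) (*-zeroʳ (count (adj G v)))))

    vanishes-at-v : ∀ m → m * uncolouredDegree q v ≤ 0
    vanishes-at-v m = ≤-trans (*-monoʳ-≤ m uncolouredDegree-q-v) (≤-reflexive (*-zeroʳ m))

    coloured-q≤ : ∀ x → coloured q x ≤ coloured p x + (𝟙 (does (v ≟ x)) + 𝟙 (adj G v x))
    coloured-q≤ x with position x
    ... | centre = begin
      coloured q v                                        ≤⟨ 𝟙≤1 (is-just (q v)) ⟩
      1                                                   ≡⟨ cong 𝟙 (dec-true (v ≟ v) refl) ⟨
      𝟙 (does (v ≟ v))                                    ≤⟨ m≤m+n _ (𝟙 (adj G v v)) ⟩
      𝟙 (does (v ≟ v)) + 𝟙 (adj G v v)                    ≤⟨ m≤n+m _ (coloured p v) ⟩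
      coloured p v + (𝟙 (does (v ≟ v)) + 𝟙 (adj G v v))   ∎
      where open ≤-Reasoning
    ... | nbr vx = begin
      coloured q x                                        ≤⟨ 𝟙≤1 (is-just (q x)) ⟩
      1                                                   ≡⟨ cong 𝟙 vx ⟨
      𝟙 (adj G v x)                                       ≤⟨ m≤n+m _ (𝟙 (does (v ≟ x))) ⟩
      𝟙 (does (v ≟ x)) + 𝟙 (adj G v x)                    ≤⟨ m≤n+m _ (coloured p x) ⟩
      coloured p x + (𝟙 (does (v ≟ x)) + 𝟙 (adj G v x))   ∎
      where open ≤-Reasoning
    ... | far x≢v vx = ≤-trans (≤-reflexive (cong (𝟙 ∘ is-just) (q-far x≢v vx))) (m≤m+n _ _)

    colouredU-q≤ : ∀ x → coloured q x * uncolouredDegree q x ≤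
                         coloured p x * uncolouredDegree p x + 𝟙 (adj G v x) * k
    colouredU-q≤ x with position x
    ... | centre = ≤-trans (vanishes-at-v (coloured q v)) z≤n
    ... | nbr vx = begin
      coloured q x * uncolouredDegree q x
        ≤⟨ *-mono-≤ (𝟙≤1 (is-just (q x))) (uncolouredDegree≤k {q} (adj-symmetric G vx) q-v) ⟩
      1 * k
        ≡⟨ cong (λ b → 𝟙 b * k) vx ⟨
      𝟙 (adj G v x) * k
        ≤⟨ m≤n+m _ _ ⟩
      coloured p x * uncolouredDegree p x + 𝟙 (adj G v x) * k ∎
      where open ≤-Reasoning
    ... | far x≢v vx = ≤-trans
      (*-mono-≤ (≤-reflexive (cong (𝟙 ∘ is-just) (q-far x≢v vx))) (uncolouredDegree-⊑ p⊑q x))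
      (m≤m+n _ _)

    otherU-q≤ : ∀ c′ x → colouredOtherThan c′ q x * uncolouredDegree q x ≤
                         colouredOtherThan c′ p x * uncolouredDegree p x + 𝟙 (adj G v x ∧ allBut c′ (σ x)) * k
    otherU-q≤ c′ x with position x
    ... | centre = ≤-trans (vanishes-at-v (colouredOtherThan c′ q v)) z≤n
    ... | nbr vx = begin
      colouredOtherThan c′ q x * uncolouredDegree q x
        ≤⟨ *-mono-≤ (≤-reflexive (cong (𝟙 ∘ otherThan c′) (q-nbr vx)))
                    (uncolouredDegree≤k {q} (adj-symmetric G vx) q-v) ⟩
      𝟙 (allBut c′ (σ x)) * k
        ≡⟨ cong (λ b → 𝟙 (b ∧ allBut c′ (σ x)) * k) vx ⟨
      𝟙 (adj G v x ∧ allBut c′ (σ x)) * k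
        ≤⟨ m≤n+m _ _ ⟩
      colouredOtherThan c′ p x * uncolouredDegree p x + 𝟙 (adj G v x ∧ allBut c′ (σ x)) * k ∎
      where open ≤-Reasoning
    ... | far x≢v vx = ≤-trans
      (*-mono-≤ (≤-reflexive (cong (𝟙 ∘ otherThan c′) (q-far x≢v vx))) (uncolouredDegree-⊑ p⊑q x))
      (m≤m+n _ _)

    load-q : load q ≤ load p + (d * d + 1)
    load-q = begin
      sum (coloured q) + ∑[ x < n ] (coloured q x * uncolouredDegree q x)
        ≤⟨ +-mono-≤ (sum-mono-≤ coloured-q≤) (sum-mono-≤ colouredU-q≤) ⟩
      ∑[ x < n ] (coloured p x + (𝟙 (does (v ≟ x)) + 𝟙 (adj G v x)))
        + ∑[ x < n ] (coloured p x * uncolouredDegree p x + 𝟙 (adj G v x) * k)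
        ≡⟨ cong₂ _+_ newly-coloured new-load ⟩
      (sum (coloured p) + (1 + d)) + (∑[ x < n ] (coloured p x * uncolouredDegree p x) + d * k)
        ≡⟨ +.interchange (sum (coloured p)) (1 + d) _ (d * k) ⟩
      load p + (1 + d + d * k)
        ≡⟨ cong (load p +_) (closed-neighbourhood-load k) ⟩
      load p + (d * d + 1) ∎
      where
      open ≤-Reasoning
      newly-coloured : ∑[ x < n ] (coloured p x + (𝟙 (does (v ≟ x)) + 𝟙 (adj G v x)))
                       ≡ sum (coloured p) + (1 + d)
      newly-coloured =
        trans (∑-distrib-+ (coloured p) (λ x → 𝟙 (does (v ≟ x)) + 𝟙 (adj G v x)))
              (cong (sum (coloured p) +_)
                    (trans (∑-distrib-+ (λ x → 𝟙 (does (v ≟ x))) (𝟙 ∘ adj G v))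
                           (cong₂ _+_ (count-singleton v) (regular v))))
      new-load : ∑[ x < n ] (coloured p x * uncolouredDegree p x + 𝟙 (adj G v x) * k)
                 ≡ ∑[ x < n ] (coloured p x * uncolouredDegree p x) + d * k
      new-load = trans (∑-distrib-+ (λ x → coloured p x * uncolouredDegree p x)
                                    (λ x → 𝟙 (adj G v x) * k))
                       (cong (_ +_) (trans (sumOver-const (adj G v) k) (cong (_* k) (regular v))))

    otherLoad-q : ∀ c′ → suc s ≤ toℕ c′ → otherLoad c′ q ≤ suc s * (k * k)
    otherLoad-q c′ s<c′ = begin
      otherLoad c′ q
        ≤⟨ sum-mono-≤ (otherU-q≤ c′) ⟩
      ∑[ x < n ] (colouredOtherThan c′ p x * uncolouredDegree p x + 𝟙 (OtherNbr x) * k)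
        ≡⟨ ∑-distrib-+ (λ x → colouredOtherThan c′ p x * uncolouredDegree p x)
                       (λ x → 𝟙 (OtherNbr x) * k) ⟩
      otherLoad c′ p + sumOver OtherNbr (λ _ → k)
        ≡⟨ cong (otherLoad c′ p +_) (sumOver-const OtherNbr k) ⟩
      otherLoad c′ p + count OtherNbr * k
        ≤⟨ +-mono-≤ (otherLoad≤ c′ (<⇒≤ s<c′)) (*-monoˡ-≤ k few-other-nbrs) ⟩
      s * (k * k) + k * k
        ≡⟨ +-comm (s * (k * k)) _ ⟩
      suc s * (k * k) ∎
      where
      open ≤-Reasoning
      OtherNbr : Fin n → Bool
      OtherNbr x = adj G v x ∧ allBut c′ (σ x)
      c′≢c : c′ ≢ c
      c′≢c c′≡c = <⇒≢ s<c′ (sym (trans (cong toℕ c′≡c) toℕ-c))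
      few-other-nbrs : count OtherNbr ≤ k
      few-other-nbrs =
        let u , vu , σu≡c′ = onto (─-intro (λ _ → true) c c′ c′≢c refl)
            OtherNbr⊆ : ∀ x → OtherNbr x ≡ true → (adj G v ─ u) x ≡ true
            OtherNbr⊆ x other-x =
              let vx , σx≢c′ = ∧-true⇒ other-x
              in ─-intro (adj G v) u x
                   (λ x≡u → ─≢ (λ _ → true) c′ (σ x) σx≢c′ (trans (cong σ x≡u) σu≡c′)) vx
        in ≤-trans (count-mono OtherNbr⊆)
                   (≤-reflexive (suc-injective (trans (sym (count-remove (adj G v) u vu)) (regular v))))

    next : Stage (suc s)
    next = record
      { colouring = q
      ; proper = proper-q
      ; dominant = dominant-q
      ; load≤ = ≤-trans load-q
                  (≤-trans (+-monoˡ-≤ _ load≤) (≤-reflexive (+-comm (s * (d * d + 1)) _)))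
      ; otherLoad≤ = otherLoad-q
      }

  next-stage : ∀ {s} → 1 ≤ k → 2 * d ^ 3 + 2 * d ∸ 2 * d ^ 2 ≤ n → s < suc d → Stage s → Stage (suc s)
  next-stage {s} 1≤k bound≤n s<1+d stage =
    let v , untouched-v , paths≤k =
          find-untouched c p s 1≤k (≤-pred s<1+d) bound≤n
                         load≤ (otherLoad≤ c (≤-reflexive (sym toℕ-c)))
        assignment = few-forbidden⇒assignment (usedNear p) d (adj G v) (allBut c)
                       (regular v) (count-allBut c)
                       (≤-trans (sumOver-mono (adj G v) λ u _ → forbidden≤ c p u) paths≤k)
    in Extension.next stage c toℕ-c v untouched-v assignment
    where
    open Stage stage renaming (colouring to p)
    c = fromℕ< s<1+d
    toℕ-c = toℕ-fromℕ< s<1+d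

  stage : 1 ≤ k → 2 * d ^ 3 + 2 * d ∸ 2 * d ^ 2 ≤ n → ∀ s → s ≤ suc d → Stage s
  stage _ _ zero _ = initial
  stage 1≤k bound≤n (suc s) s<1+d =
    next-stage 1≤k bound≤n s<1+d (stage 1≤k bound≤n s (<⇒≤ s<1+d))

  b-colouring : 1 ≤ k → 2 * d ^ 3 + 2 * d ∸ 2 * d ^ 2 ≤ n → HasBColoring G (suc d)
  b-colouring 1≤k bound≤n =
    dominant-partial⇒b-colouring (≤-reflexive ∘ regular) colouring proper λ a → dominant a (toℕ<n a)
    where open Stage (stage 1≤k bound≤n (suc d) ≤-refl)

-- For d = 1 the averaging bound fails (n may be 2), but a single edge carries both dominant vertices.
module Matching {n : ℕ} (G : Graph n) (regular : ∀ v → count (adj G v) ≡ 1) where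

  open PartialColourings {n} {1} G

  b-colouring : Fin n → HasBColoring G 2
  b-colouring x = dominant-partial⇒b-colouring (≤-reflexive ∘ regular) p₁ proper₁ dominants
    where
    edge = 0<count⇒∃ (adj G x) (subst (0 <_) (sym (regular x)) (s≤s z≤n))
    y = proj₁ edge
    xy = proj₂ edge

    p₀ p₁ : PartialColouring
    p₀ = (λ _ → nothing) [ x ≔ fzero ]
    p₁ = p₀ [ y ≔ fsuc fzero ]

    unused : ∀ {u} → adj G y u ≡ true → p₀ u ≢ just (fsuc fzero)
    unused {u} _ with u ≟ x
    ... | yes _ = λ ()
    ... | no _ = λ ()

    proper₁ : ProperPartial p₁
    proper₁ = [≔]-proper ([≔]-proper (λ _ ()) λ _ ()) unused

    p₁-x : p₁ x ≡ just fzero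
    p₁-x = ⊑-[≔] {p₀} {y} {fsuc fzero} p₀-y {x} ([≔]-at (λ _ → nothing) x fzero)
      where
      p₀-y : p₀ y ≡ nothing
      p₀-y rewrite dec-false (y ≟ x) (≢-sym (adj-irreflexive G xy)) = refl

    p₁-y : p₁ y ≡ just (fsuc fzero)
    p₁-y = [≔]-at p₀ y (fsuc fzero)

    dominants : ∀ a → ∃ (DominantFor p₁ a)
    dominants fzero = x , p₁-x , λ
      { fzero 0≢0 → contradiction refl 0≢0
      ; (fsuc fzero) _ → y , xy , p₁-y }
    dominants (fsuc fzero) = y , p₁-y , λ
      { fzero _ → x , adj-symmetric G xy , p₁-x
      ; (fsuc fzero) 1≢1 → contradiction refl 1≢1 }

regular⇒b-colouring : ∀ {n d} (G : Graph n) → 1 ≤ d → Regular d G →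
  2 * d ^ 3 + 2 * d ∸ 2 * d ^ 2 ≤ n → HasBColoring G (suc d)
regular⇒b-colouring {n} {suc zero} G _ regular bound≤n =
  Matching.b-colouring G (λ v → trans (sym (degree≡count G v)) (regular v)) (fromℕ< bound≤n)
regular⇒b-colouring {n} {suc (suc k)} G _ regular bound≤n =
  Construction.b-colouring G (λ v → trans (sym (degree≡count G v)) (regular v)) (s≤s z≤n) bound≤n

theorem2p2 : (d n : ℕ) → 1 ≤ d → (G : Graph n) → Regular d G →
    2 * d ^ 3 + 2 * d ∸ 2 * d ^ 2 ≤ n →
    BChromaticNumber G (d + 1)
theorem2p2 d n 1≤d G regular bound≤n =
  subst (HasBColoring G) (+-comm 1 d) (regular⇒b-colouring G 1≤d regular bound≤n) ,
  λ k has-k → subst (k ≤_) (+-comm 1 d) (b-colouring⇒≤1+d G regular k has-k)
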